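{- Let $\sigma$ be a cyclic permutation of $[n]$ and let $\mathcal{G}$ be a $2$-Sperner family of intervals along $\sigma$ having exactly $I$ isolated intervals. Then $|\mathcal{G}|\le 2n-I$.
   Context: A cyclic permutation of $[n]$ is an arrangement of $1,\dots,n$ around a circle; an interval along $\sigma$ is a nonempty set of circularly consecutive elements. A family is $2$-Sperner if it contains no three members $G_1\subsetneq G_2\subsetneq G_3$. A member of $\mathcal{G}$ is isolated if it is comparable (under inclusion) with no other member of $\mathcal{G}$. -}

module Defs where

open import Data.Nat using (ℕ; _+_; _<_; _≤_)
open import Data.Fin using (Fin; toℕ)
open import Data.Fin.Subset using (Subset; _∈_; _⊆_; _⊂_)
open import Data.Fin.Permutation using (Permutation′; _⟨$⟩ʳ_)
open import Data.Product using (Σ; _×_; ∃; ∃-syntax)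
open import Data.Sum using (_⊎_)
open import Data.List using (List)
import Data.List.Membership.Propositional as LM
open import Relation.Binary.PropositionalEquality using (_≡_; _≢_)
open import Relation.Nullary using (¬_)
open import Function.Bundles using (_⇔_)

-- A cyclic permutation (cyclic arrangement) of [n] = Fin n:
-- σ ⟨$⟩ʳ p is the element sitting at position p (positions 0..n-1 around
-- the circle, position n-1 followed by position 0).
CyclicPerm : ℕ → Set
CyclicPerm n = Permutation′ n

-- Position q is one of the k circularly consecutive positions
-- a, a+1, ..., a+k-1 (taken mod n).  Since a, q < n and j < k ≤ n,
-- "a + j ≡ q (mod n)" is exactly "a + j ≡ q or a + j ≡ q + n".
InArc : ∀ {n} → Fin n → ℕ → Fin n → Set
InArc {n} a k q = ∃[ j ] (j < k × (toℕ a + j ≡ toℕ q ⊎ toℕ a + j ≡ toℕ q + n))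

IsInterval : ∀ {n} → CyclicPerm n → Subset n → Set
IsInterval {n} σ S =
  Σ (Fin n) λ a → Σ ℕ λ k → 1 ≤ k × k ≤ n ×
    (∀ x → (x ∈ S) ⇔ (∃[ q ] (σ ⟨$⟩ʳ q ≡ x × InArc a k q)))

open LM using () renaming (_∈_ to _∈ₗ_)

TwoSperner : ∀ {n} → List (Subset n) → Set
TwoSperner 𝒢 = ∀ {A B C} → A ∈ₗ 𝒢 → B ∈ₗ 𝒢 → C ∈ₗ 𝒢 → ¬ (A ⊂ B × B ⊂ C)

Comparable : ∀ {n} → Subset n → Subset n → Set
Comparable A B = A ⊆ B ⊎ B ⊆ A

Isolated : ∀ {n} → List (Subset n) → Subset n → Set
Isolated 𝒢 S = S ∈ₗ 𝒢 × (∀ {T} → T ∈ₗ 𝒢 → T ≢ S → ¬ Comparable S T)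

-- Every interval along σ has a start position, and any two intervals with the
-- same start are nested. So the members of 𝒢 starting at a fixed position form a
-- chain, which by 2-Sperner has at most two members; if that chain contains an
-- isolated interval, it is the only member. Hence each of the n positions
-- contributes at most 2 to |𝒢| + I.
module Submission where

open import Defs
open import Data.Nat as ℕ using (ℕ; _+_; _*_; _≤_; suc; z≤n; s≤s)
open import Data.Nat.Properties
  using (module ≤-Reasoning; ≤-total; <-≤-trans; +-mono-≤; +-identityʳ; *-comm; +-0-commutativeMonoid)
open import Data.Fin using (Fin; zero; suc; _≟_)
open import Data.Fin.Properties using (any?)
open import Data.Fin.Subset using (Subset; _⊆_; _⊂_)
open import Data.Fin.Subset.Properties using (_∈?_; ⊆-antisym)
open import Data.Bool using (true; false; if_then_else_)
import Data.Bool as Bool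
open import Data.Vec.Properties using (≡-dec)
open import Data.List using (List; []; _∷_; length; map; filter)
open import Data.List.Properties using (length-map)
open import Data.List.Relation.Unary.All as All using (All; []; _∷_)
import Data.List.Relation.Unary.AllPairs.Properties as AllPairs
open import Data.List.Relation.Unary.AllPairs using ([]; _∷_)
open import Data.List.Relation.Unary.Any using (here; there)
open import Data.List.Relation.Unary.Unique.Propositional using (Unique)
open import Data.List.Membership.Propositional using (_∈_)
open import Data.List.Membership.Propositional.Properties using (∈-map⁺; ∈-map⁻; ∈-filter⁻)
import Data.Product as Product
open import Data.Product using (Σ; ∃; _×_; _,_; proj₁; proj₂)
open import Data.Sum using (inj₁; inj₂)
open import Data.Empty using (⊥; ⊥-elim)
open import Function.Base using (_∘_)
open import Function.Bundles using (_⇔_; Equivalence)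
open import Relation.Unary using (Decidable)
open import Relation.Nullary using (Dec; yes; no; does; contradiction)
open import Relation.Nullary.Decidable using (_×-dec_; ¬?)
open import Relation.Binary.PropositionalEquality
  using (_≡_; _≢_; ≢-sym; refl; sym; trans; cong; cong₂; subst; module ≡-Reasoning)
open import Algebra.Properties.CommutativeMonoid.Sum +-0-commutativeMonoid
  using (sum-syntax; ∑-distrib-+; sum-cong-≗; sum-replicate-zero)

open Equivalence using (to; from)

_≟ₛ_ : ∀ {n} (A B : Subset n) → Dec (A ≡ B)
_≟ₛ_ = ≡-dec Bool._≟_

⊆∧≢⇒⊂ : ∀ {n} {A B : Subset n} → A ⊆ B → A ≢ B → A ⊂ B
⊆∧≢⇒⊂ {A = A} {B} A⊆B A≢B with any? (λ x → (x ∈? B) ×-dec ¬? (x ∈? A))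
... | yes witness = A⊆B , witness
... | no B⊈A      = contradiction (⊆-antisym A⊆B B⊆A) A≢B
  where
  B⊆A : B ⊆ A
  B⊆A {x} x∈B with x ∈? A
  ... | yes x∈A = x∈A
  ... | no  x∉A = contradiction (x , x∈B , x∉A) B⊈A

Unique-All-≡⇒length≤1 : ∀ {A : Set} {a : A} {xs : List A} → Unique xs → All (_≡ a) xs → length xs ≤ 1
Unique-All-≡⇒length≤1 []              []                = z≤n
Unique-All-≡⇒length≤1 (_ ∷ [])        (_ ∷ [])          = s≤s z≤n
Unique-All-≡⇒length≤1 ((x≢y ∷ _) ∷ _) (refl ∷ refl ∷ _) = contradiction refl x≢y

module _ {n : ℕ} {𝒢 : List (Subset n)} where

  isolated-comparable⇒≡ : ∀ {S T} → Isolated 𝒢 S → T ∈ 𝒢 → Comparable S T → T ≡ S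
  isolated-comparable⇒≡ {S} {T} (_ , alone) T∈𝒢 S~T with T ≟ₛ S
  ... | yes T≡S = T≡S
  ... | no  T≢S = contradiction S~T (alone T∈𝒢 T≢S)

  length≤1-around-isolated : ∀ {S C} → Isolated 𝒢 S → Unique C →
                             (∀ {T} → T ∈ C → T ∈ 𝒢 × Comparable S T) → length C ≤ 1
  length≤1-around-isolated isoS uC C~S =
    Unique-All-≡⇒length≤1 uC (All.tabulate λ T∈C →
      let (T∈𝒢 , S~T) = C~S T∈C in isolated-comparable⇒≡ isoS T∈𝒢 S~T)

  module _ (sperner : TwoSperner 𝒢) where

    ⊂-incomparable-third : ∀ {A B C} → A ∈ 𝒢 → B ∈ 𝒢 → C ∈ 𝒢 → A ⊂ B →
                           Comparable C A → Comparable C B → C ≢ A → C ≢ B → ⊥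
    ⊂-incomparable-third A∈ B∈ C∈ A⊂B _ (inj₂ B⊆C) _ C≢B =
      sperner A∈ B∈ C∈ (A⊂B , ⊆∧≢⇒⊂ B⊆C (≢-sym C≢B))
    ⊂-incomparable-third A∈ B∈ C∈ A⊂B (inj₁ C⊆A) (inj₁ _) C≢A _ =
      sperner C∈ A∈ B∈ (⊆∧≢⇒⊂ C⊆A C≢A , A⊂B)
    ⊂-incomparable-third A∈ B∈ C∈ A⊂B (inj₂ A⊆C) (inj₁ C⊆B) C≢A C≢B =
      sperner A∈ C∈ B∈ (⊆∧≢⇒⊂ A⊆C (≢-sym C≢A) , ⊆∧≢⇒⊂ C⊆B C≢B)

    ¬three-comparable : ∀ {A B C} → A ∈ 𝒢 → B ∈ 𝒢 → C ∈ 𝒢 → A ≢ B → A ≢ C → B ≢ C →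
                        Comparable A B → Comparable C A → Comparable C B → ⊥
    ¬three-comparable A∈ B∈ C∈ A≢B A≢C B≢C (inj₁ A⊆B) C~A C~B =
      ⊂-incomparable-third A∈ B∈ C∈ (⊆∧≢⇒⊂ A⊆B A≢B) C~A C~B (≢-sym A≢C) (≢-sym B≢C)
    ¬three-comparable A∈ B∈ C∈ A≢B A≢C B≢C (inj₂ B⊆A) C~A C~B =
      ⊂-incomparable-third B∈ A∈ C∈ (⊆∧≢⇒⊂ B⊆A (≢-sym A≢B)) C~B C~A (≢-sym B≢C) (≢-sym A≢C)

    chain-length≤2 : ∀ {C} → Unique C → (∀ {T} → T ∈ C → T ∈ 𝒢) →
                     (∀ {S T} → S ∈ C → T ∈ C → Comparable S T) → length C ≤ 2
    chain-length≤2 {[]}             _ _ _ = z≤n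
    chain-length≤2 {_ ∷ []}         _ _ _ = s≤s z≤n
    chain-length≤2 {_ ∷ _ ∷ []}     _ _ _ = s≤s (s≤s z≤n)
    chain-length≤2 {a ∷ b ∷ c ∷ rest} ((a≢b ∷ a≢c ∷ _) ∷ (b≢c ∷ _) ∷ _) ⊆𝒢 chain =
      ⊥-elim (¬three-comparable (⊆𝒢 a∈) (⊆𝒢 b∈) (⊆𝒢 c∈) a≢b a≢c b≢c
                (chain a∈ b∈) (chain c∈ a∈) (chain c∈ b∈))
      where
      a∈ : a ∈ a ∷ b ∷ c ∷ rest
      a∈ = here refl
      b∈ : b ∈ a ∷ b ∷ c ∷ rest
      b∈ = there (here refl)
      c∈ : c ∈ a ∷ b ∷ c ∷ rest
      c∈ = there (there (here refl))

    chain+isolated≤2 : ∀ {Q : Subset n → Set} → (∀ {S T} → Q S → Q T → Comparable S T) →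
                       ∀ {C D} → Unique C → Unique D →
                       (∀ {T} → T ∈ C → T ∈ 𝒢 × Q T) → (∀ {T} → T ∈ D → Isolated 𝒢 T × Q T) →
                       length C + length D ≤ 2
    chain+isolated≤2 Q-comparable {C} {[]} uC _ C⊆ _ =
      subst (_≤ 2) (sym (+-identityʳ (length C)))
        (chain-length≤2 uC (proj₁ ∘ C⊆) λ S∈ T∈ → Q-comparable (proj₂ (C⊆ S∈)) (proj₂ (C⊆ T∈)))
    chain+isolated≤2 {Q} Q-comparable {C} {S ∷ _} uC uD C⊆ D⊆ =
      +-mono-≤ (length≤1-around-isolated isoS uC λ T∈C →
                  let (T∈𝒢 , QT) = C⊆ T∈C in T∈𝒢 , Q-comparable QS QT)
               (length≤1-around-isolated isoS uD λ T∈D →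
                  let (isoT , QT) = D⊆ T∈D in proj₁ isoT , Q-comparable QS QT)
      where
      isoS : Isolated 𝒢 S
      isoS = proj₁ (D⊆ (here refl))
      QS : Q S
      QS = proj₂ (D⊆ (here refl))

∑-indicator : ∀ {n} (a : Fin n) → ∑[ p < n ] (if does (a ≟ p) then 1 else 0) ≡ 1
∑-indicator {suc n} zero    = cong suc (sum-replicate-zero n)
∑-indicator {suc n} (suc a) = ∑-indicator a

∑-≤-* : ∀ {n c} (f : Fin n → ℕ) → (∀ p → f p ≤ c) → ∑[ p < n ] f p ≤ n * c
∑-≤-* {ℕ.zero} f _   = z≤n
∑-≤-* {suc n}  f f≤c = +-mono-≤ (f≤c zero) (∑-≤-* (f ∘ suc) (f≤c ∘ suc))

module _ {A : Set} {P : A → Set} (P? : Decidable P) where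

  length-filter-∷ : ∀ x xs → length (filter P? (x ∷ xs)) ≡ (if does (P? x) then 1 else 0) + length (filter P? xs)
  length-filter-∷ x xs with does (P? x)
  ... | true  = refl
  ... | false = refl

length≡∑-fibres : ∀ {A : Set} {n} (f : A → Fin n) (xs : List A) →
                  length xs ≡ ∑[ p < n ] length (filter (λ x → f x ≟ p) xs)
length≡∑-fibres {n = n} f []       = sym (sum-replicate-zero n)
length≡∑-fibres {n = n} f (x ∷ xs) = begin
  1 + length xs
    ≡⟨ cong₂ _+_ (sym (∑-indicator (f x))) (length≡∑-fibres f xs) ⟩
  ∑[ p < n ] (if does (f x ≟ p) then 1 else 0) + ∑[ p < n ] length (filter (λ y → f y ≟ p) xs)
    ≡⟨ sym (∑-distrib-+ (λ p → if does (f x ≟ p) then 1 else 0) _) ⟩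
  ∑[ p < n ] ((if does (f x ≟ p) then 1 else 0) + length (filter (λ y → f y ≟ p) xs))
    ≡⟨ sum-cong-≗ (λ p → sym (length-filter-∷ (λ y → f y ≟ p) x xs)) ⟩
  ∑[ p < n ] length (filter (λ y → f y ≟ p) (x ∷ xs))
    ∎
  where open ≡-Reasoning

module Fibres {A : Set} {P : A → Set} {n : ℕ} (key : ∀ {x} → P x → Fin n) where

  keyed? : (p : Fin n) → Decidable (λ (t : ∃ P) → key (proj₂ t) ≡ p)
  keyed? p t = key (proj₂ t) ≟ p

  fibre : Fin n → ∀ {xs} → All P xs → List A
  fibre p pxs = map proj₁ (filter (keyed? p) (All.toList pxs))

  toList-carriers : ∀ {xs} (pxs : All P xs) → map proj₁ (All.toList pxs) ≡ xs
  toList-carriers []         = refl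
  toList-carriers (_ ∷ pxs) = cong (_ ∷_) (toList-carriers pxs)

  ∈-fibre⁻ : ∀ {p xs x} (pxs : All P xs) → x ∈ fibre p pxs → x ∈ xs × Σ (P x) λ px → key px ≡ p
  ∈-fibre⁻ pxs x∈ with ∈-map⁻ proj₁ x∈
  ... | (_ , px) , t∈ , refl with ∈-filter⁻ (keyed? _) t∈
  ...   | t∈toList , keyed = subst (_ ∈_) (toList-carriers pxs) (∈-map⁺ proj₁ t∈toList) , px , keyed

  fibre-unique : ∀ {p xs} (pxs : All P xs) → Unique xs → Unique (fibre p pxs)
  fibre-unique pxs u = AllPairs.map⁺ (AllPairs.filter⁺ _
    (AllPairs.map⁻ (subst Unique (sym (toList-carriers pxs)) u)))

  length≡∑-length-fibre : ∀ {xs} (pxs : All P xs) → length xs ≡ ∑[ p < n ] length (fibre p pxs)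
  length≡∑-length-fibre {xs} pxs = begin
    length xs                               ≡⟨ cong length (sym (toList-carriers pxs)) ⟩
    length (map proj₁ tagged)               ≡⟨ length-map proj₁ tagged ⟩
    length tagged                           ≡⟨ length≡∑-fibres (key ∘ proj₂) tagged ⟩
    ∑[ p < n ] length (filter (keyed? p) tagged)
      ≡⟨ sum-cong-≗ (λ p → sym (length-map proj₁ (filter (keyed? p) tagged))) ⟩
    ∑[ p < n ] length (fibre p pxs)         ∎
    where
    open ≡-Reasoning
    tagged : List (∃ P)
    tagged = All.toList pxs

InArc-mono : ∀ {n} {a q : Fin n} {k k′} → k ≤ k′ → InArc a k q → InArc a k′ q
InArc-mono k≤k′ (j , j<k , wraps) = j , <-≤-trans j<k k≤k′ , wraps

module Intervals {n : ℕ} (σ : CyclicPerm n) where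

  -- The start is read off the witness, not the set: the whole circle starts anywhere.
  start : ∀ {S} → IsInterval σ S → Fin n
  start = proj₁

  span : ∀ {S} → IsInterval σ S → ℕ
  span = proj₁ ∘ proj₂

  sameStart∧shorter⇒⊆ : ∀ {S T} (v : IsInterval σ S) (w : IsInterval σ T) →
                        start v ≡ start w → span v ≤ span w → S ⊆ T
  sameStart∧shorter⇒⊆ (_ , _ , _ , _ , S⇔) (_ , _ , _ , _ , T⇔) refl k≤k′ {x} x∈S =
    let (q , σq≡x , q∈arc) = to (S⇔ x) x∈S in from (T⇔ x) (q , σq≡x , InArc-mono k≤k′ q∈arc)

  sameStart⇒comparable : ∀ {S T} (v : IsInterval σ S) (w : IsInterval σ T) →
                         start v ≡ start w → Comparable S T
  sameStart⇒comparable v w same with ≤-total (span v) (span w)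
  ... | inj₁ v≤w = inj₁ (sameStart∧shorter⇒⊆ v w same v≤w)
  ... | inj₂ w≤v = inj₂ (sameStart∧shorter⇒⊆ w v (sym same) w≤v)

  StartsAt : Fin n → Subset n → Set
  StartsAt p S = Σ (IsInterval σ S) λ v → start v ≡ p

  startsAt-comparable : ∀ {p S T} → StartsAt p S → StartsAt p T → Comparable S T
  startsAt-comparable (v , v≡p) (w , w≡p) = sameStart⇒comparable v w (trans v≡p (sym w≡p))

lemma4 : (n : ℕ) (σ : CyclicPerm n) (𝒢 : List (Subset n)) →
         Unique 𝒢 → All (IsInterval σ) 𝒢 → TwoSperner 𝒢 →
         (iso : List (Subset n)) → Unique iso →
         (∀ S → (S ∈ iso) ⇔ Isolated 𝒢 S) →
         length 𝒢 + length iso ≤ 2 * n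
lemma4 n σ 𝒢 u𝒢 𝒢-intervals sperner iso uiso iso⇔isolated = begin
  length 𝒢 + length iso
    ≡⟨ cong₂ _+_ (length≡∑-length-fibre 𝒢-intervals) (length≡∑-length-fibre iso-intervals) ⟩
  ∑[ p < n ] length (fibre p 𝒢-intervals) + ∑[ p < n ] length (fibre p iso-intervals)
    ≡⟨ sym (∑-distrib-+ (λ p → length (fibre p 𝒢-intervals)) _) ⟩
  ∑[ p < n ] (length (fibre p 𝒢-intervals) + length (fibre p iso-intervals))
    ≤⟨ ∑-≤-* _ fibres≤2 ⟩
  n * 2
    ≡⟨ *-comm n 2 ⟩
  2 * n ∎
  where
  open ≤-Reasoning hiding (start)
  open Intervals σ
  open Fibres start

  isolated : ∀ {S} → S ∈ iso → Isolated 𝒢 S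
  isolated {S} = to (iso⇔isolated S)

  iso-intervals : All (IsInterval σ) iso
  iso-intervals = All.tabulate (All.lookup 𝒢-intervals ∘ proj₁ ∘ isolated)

  fibres≤2 : ∀ p → length (fibre p 𝒢-intervals) + length (fibre p iso-intervals) ≤ 2
  fibres≤2 p = chain+isolated≤2 sperner (startsAt-comparable {p = p})
    (fibre-unique 𝒢-intervals u𝒢) (fibre-unique iso-intervals uiso)
    (∈-fibre⁻ 𝒢-intervals) (Product.map₁ isolated ∘ ∈-fibre⁻ iso-intervals)
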